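{- Let $U$ be a countably infinite set and $\mathrm{G}$ a subgroup of $\mathfrak{S}(U)$. Then for every subset $S$ of $U$, the ranked closure $\mathfrak{rc}(S)$ is the least element (with respect to inclusion) of $\overline{\overline{\mathrm{G}}[U]}$ containing $S$, where $\overline{\overline{\mathrm{G}}[U]}$ is the topological closure of $\overline{\mathrm{G}}[U]$ in $\mathcal{P}(U)$ for the powerset topology.
   Context: $\overline{\mathrm{G}}$ is the closure of $\mathrm{G}$ in $U^U$ for the function topology (maps $f:U\to U$ such that every finite restriction of $f$ is a restriction of some $g\in\mathrm{G}$); $\overline{\mathrm{G}}[U]=\{f[U]\mid f\in\overline{\mathrm{G}}\}$. The powerset topology on $\mathcal{P}(U)$ has basic open sets $\{A\subseteq U\mid F\subseteq A,\ E\cap A=\emptyset\}$, $F,E$ finite. For $F\subseteq U$, $\mathrm{G}\langle F\rangle=\{g\in\mathrm{G}\mid g(x)=x\ \forall x\in F\}$. A type is a pair $\langle F\mid p\rangle$ with $F$ finite, $p\in U$; its typeset is $\mathrm{G}\langle F\mid p\rangle=\{g(p)\mid g\in\mathrm{G}\langle F\rangle\}$. $\mathfrak{R}_0$ is the set of types with finite typeset; $\langle F\mid p\rangle\in\mathfrak{R}_\alpha$ if there is a finite $F'\supseteq F$ such that for every $q\in\mathrm{G}\langle F\mid p\rangle$, $\langle F'\mid q\rangle\in\mathfrak{R}_\beta$ for some $\beta<\alpha$. A type is ranked if it lies in some $\mathfrak{R}_\alpha$. For finite $F$, $\mathfrak{rc}(F)$ is $F$ together with the union of the typesets of the ranked types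 $\langle F\mid p\rangle$; for arbitrary $S$, $\mathfrak{rc}(S)=\bigcup\{\mathfrak{rc}(F)\mid F\text{ a finite subset of } S\}$. -}

module Defs where

open import Level using (0ℓ)
open import Data.Nat using (ℕ)
open import Data.List using (List)
open import Data.List.Membership.Propositional using (_∈_)
open import Data.List.Relation.Unary.All using (All)
open import Data.Product using (Σ; ∃; _×_)
open import Data.Sum using (_⊎_)
open import Data.Empty using (⊥)
open import Relation.Nullary using (¬_)
open import Relation.Binary.PropositionalEquality using (_≡_)
open import Function.Bundles using (_↔_; _⤖_; Inverse)
open import Function.Properties.Inverse using (↔-refl; ↔-sym; ↔-trans)

Perm : Set → Set
Perm U = U ↔ U

ap : {U : Set} → Perm U → U → U
ap g = Inverse.to g

Subset : Set → Set₁
Subset U = U → Set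

_⊆_ : {U : Set} → Subset U → Subset U → Set
A ⊆ B = ∀ x → A x → B x

CountablyInfinite : Set → Set
CountablyInfinite U = ℕ ⤖ U

-- Since
-- permutations are records, we require the predicate to depend only on
-- the underlying function (a permutation is determined by it).
record IsSubgroup {U : Set} (G : Perm U → Set) : Set₁ where
  field
    respects : ∀ g h → (∀ x → ap g x ≡ ap h x) → G g → G h
    id∈      : G ↔-refl
    ∘∈       : ∀ g h → G g → G h → G (↔-trans h g)
    inv∈     : ∀ g → G g → G (↔-sym g)

module _ {U : Set} (G : Perm U → Set) where

  -- Ḡ : closure of G in U^U (function topology)
  Closure : (U → U) → Set
  Closure f = (xs : List U) → Σ (Perm U) λ g → G g × (∀ x → x ∈ xs → ap g x ≡ f x)

  Image : (U → U) → Subset U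
  Image f y = ∃ λ u → f u ≡ y

  -- Ḡ[U] = { f[U] | f ∈ Ḡ }  (set equality is extensional: ⊆ both ways)
  ClosureImages : Subset U → Set
  ClosureImages A = Σ (U → U) λ f → Closure f × (A ⊆ Image f × Image f ⊆ A)

  InBasicOpen : List U → List U → Subset U → Set
  InBasicOpen F E A = All A F × All (λ x → ¬ A x) E

  -- topological closure of Ḡ[U] in 𝒫(U): every basic open neighbourhood
  -- of A meets Ḡ[U]
  ClosureOfImages : Subset U → Set₁
  ClosureOfImages A = (F E : List U) → InBasicOpen F E A →
                      Σ (Subset U) λ B → ClosureImages B × InBasicOpen F E B

  Fixes : List U → Perm U → Set
  Fixes F g = ∀ x → x ∈ F → ap g x ≡ x

  TypeSet : List U → U → Subset U
  TypeSet F p y = Σ (Perm U) λ g → G g × Fixes F g × ap g p ≡ y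

  Finite : Subset U → Set
  Finite A = Σ (List U) λ xs → ∀ x → A x → x ∈ xs

  -- Ranked types: the union over all ordinals α of ℜ_α, i.e. the least
  -- family closed under the two clauses of the definition.
  data Ranked : List U → U → Set where
    rank0    : ∀ {F p} → Finite (TypeSet F p) → Ranked F p
    rankStep : ∀ {F p} (F' : List U) → (∀ x → x ∈ F → x ∈ F') →
               (∀ q → TypeSet F p q → Ranked F' q) → Ranked F p

  rcFin : List U → Subset U
  rcFin F x = x ∈ F ⊎ Σ U λ p → Ranked F p × TypeSet F p x

  rc : Subset U → Subset U
  rc S x = Σ (List U) λ F → All S F × rcFin F x

-- A ranked type ⟨F | y⟩ forces y into the image of every f ∈ Ḡ fixing F, by
-- induction on the rank: f agrees with some g ∈ G on F and the finitely many points
-- that matter, and g⁻¹ moves y inside its typeset.  This gives minimality: a closed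
-- A ⊇ S missing x ∈ 𝔯𝔠(F) is approximated by some f[U] containing F but not x, and f
-- can be normalised to fix F.
--
-- Conversely a point e unranked over F is avoided by some f ∈ Ḡ fixing F.  Enumerate
-- U as u₀, u₁, … and build g₀ = id, g₁, … in G, each agreeing with the previous one on
-- F ∪ {u₀,…,uₙ₋₁}, keeping e unranked over gₙ[F ∪ {u₀,…,uₙ₋₁}]; one more point can be
-- added because if ⟨K | e⟩ is unranked, some point of its typeset is unranked over
-- K ∪ {a}.  The limit f lies in Ḡ, and each f(u) is ranked over one of these finite
-- sets, so f misses e.  Since elements of Ḡ are injective, such maps compose to avoid
-- any finite set E of points outside 𝔯𝔠(S), while still covering 𝔯𝔠(S).

module Submission where

open import Defs
open import Level using (0ℓ; suc)
open import Data.Product using (_×_)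
open import Axiom.ExcludedMiddle using (ExcludedMiddle)

open import Axiom.DoubleNegationElimination using (em⇒dne)
open import Data.Empty using (⊥-elim)
open import Data.List using (List; []; _∷_; _++_; map)
open import Data.List.Membership.Propositional using (_∈_)
open import Data.List.Membership.Propositional.Properties using (∈-map⁺; ∈-map⁻)
open import Data.List.Properties using (map-∘; map-cong; map-id)
open import Data.List.Relation.Binary.Subset.Propositional using () renaming (_⊆_ to _⊆ₗ_)
open import Data.List.Relation.Binary.Subset.Propositional.Properties
  using (xs⊆xs++ys; xs⊆ys++xs) renaming (map⁺ to map⁺-⊆ₗ)
open import Data.List.Relation.Unary.All as All using (All; []; _∷_)
open import Data.List.Relation.Unary.All.Properties using (++⁺)
open import Data.List.Relation.Unary.Any using (here; there)
open import Data.Nat as ℕ using (ℕ; zero; _≤′_; ≤′-refl; ≤′-step; _⊔_)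
open import Data.Nat.Properties using (≤⇒≤′; m≤m⊔n; m≤n⊔m)
open import Data.Product using (Σ; ∃; _,_; proj₁; proj₂)
open import Data.Sum using (inj₁; inj₂)
open import Function using (id; _∘_)
open import Function.Bundles using (Inverse; Bijection)
open import Function.Definitions using (StrictlySurjective)
open import Function.Properties.Inverse using (↔-refl; ↔-sym; ↔-trans)
open import Relation.Nullary using (¬_; yes; no)
open import Relation.Binary.PropositionalEquality using (_≡_; refl; sym; trans; cong; cong₂; subst)

counterexample : ExcludedMiddle 0ℓ → {A : Set} {P Q : A → Set} →
                 ¬ (∀ x → P x → Q x) → ∃ λ x → P x × ¬ Q x
counterexample em ¬∀ =
  em⇒dne em λ ¬∃ → ¬∀ λ x px → em⇒dne em λ ¬qx → ¬∃ (x , px , ¬qx)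

module Subgroup {U : Set} {G : Perm U → Set} (G-subgroup : IsSubgroup G) where
  open IsSubgroup G-subgroup

  _⁻¹ : Perm U → Perm U
  _⁻¹ = ↔-sym

  ap-inverseˡ : ∀ g x → ap (g ⁻¹) (ap g x) ≡ x
  ap-inverseˡ = Inverse.strictlyInverseʳ

  ap-inverseʳ : ∀ g y → ap g (ap (g ⁻¹) y) ≡ y
  ap-inverseʳ = Inverse.strictlyInverseˡ

  map-ap-inverseʳ : ∀ g xs → map (ap g) (map (ap (g ⁻¹)) xs) ≡ xs
  map-ap-inverseʳ g xs =
    trans (sym (map-∘ xs)) (trans (map-cong (ap-inverseʳ g) xs) (map-id xs))

  Fixes-⁻¹ : ∀ {F g} → Fixes G F g → Fixes G F (g ⁻¹)
  Fixes-⁻¹ {g = g} g-fixes x x∈F =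
    trans (cong (ap (g ⁻¹)) (sym (g-fixes x x∈F))) (ap-inverseˡ g x)

  FixesMap : List U → (U → U) → Set
  FixesMap F f = ∀ x → x ∈ F → f x ≡ x

  Closure-perm : ∀ {g} → G g → Closure G (ap g)
  Closure-perm {g} g∈G xs = g , g∈G , λ _ _ → refl

  Closure-∘ : ∀ {f f′} → Closure G f → Closure G f′ → Closure G (f ∘ f′)
  Closure-∘ {f} {f′} f-cl f′-cl xs =
    let g′ , g′∈G , g′≈f′ = f′-cl xs
        g , g∈G , g≈f = f-cl (map f′ xs)
    in ↔-trans g′ g , ∘∈ g g′ g∈G g′∈G ,
       λ x x∈ → trans (cong (ap g) (g′≈f′ x x∈)) (g≈f (f′ x) (∈-map⁺ f′ x∈))

  Closure-injective : ∀ {f x y} → Closure G f → f x ≡ f y → x ≡ y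
  Closure-injective {f} {x} {y} f-cl fx≡fy =
    let g , _ , g≈f = f-cl (x ∷ y ∷ [])
        gx≡gy = trans (g≈f x (here refl)) (trans fx≡fy (sym (g≈f y (there (here refl)))))
    in trans (sym (ap-inverseˡ g x)) (trans (cong (ap (g ⁻¹)) gx≡gy) (ap-inverseˡ g y))

  TypeSet-refl : ∀ {F p} → TypeSet G F p p
  TypeSet-refl = ↔-refl , id∈ , (λ _ _ → refl) , refl

  TypeSet-trans : ∀ {F p q y} → TypeSet G F p q → TypeSet G F q y → TypeSet G F p y
  TypeSet-trans (g , g∈G , g-fixes , gp≡q) (h , h∈G , h-fixes , hq≡y) =
    ↔-trans g h , ∘∈ h g h∈G g∈G ,
    (λ x x∈F → trans (cong (ap h) (g-fixes x x∈F)) (h-fixes x x∈F)) ,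
    trans (cong (ap h) gp≡q) hq≡y

  TypeSet-⁻¹ : ∀ {F g} → G g → Fixes G F g → ∀ y → TypeSet G F y (ap (g ⁻¹) y)
  TypeSet-⁻¹ {F} {g} g∈G g-fixes y = g ⁻¹ , inv∈ g g∈G , Fixes-⁻¹ {F} {g} g-fixes , refl

  TypeSet-unconj : ∀ {k F p y} → G k →
                   TypeSet G (map (ap k) F) (ap k p) y → TypeSet G F p (ap (k ⁻¹) y)
  TypeSet-unconj {k} k∈G (g , g∈G , g-fixes , gkp≡y) =
    ↔-trans (↔-trans k g) (k ⁻¹) , ∘∈ (k ⁻¹) _ (inv∈ k k∈G) (∘∈ g k g∈G k∈G) ,
    (λ x x∈F → trans (cong (ap (k ⁻¹)) (g-fixes (ap k x) (∈-map⁺ (ap k) x∈F)))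
                     (ap-inverseˡ k x)) ,
    cong (ap (k ⁻¹)) gkp≡y

  Ranked-mono : ∀ {F F′ p} → F ⊆ₗ F′ → Ranked G F p → Ranked G F′ p
  Ranked-mono F⊆F′ (rank0 (xs , typeSet⊆xs)) =
    rank0 (xs , λ y (g , g∈G , g-fixes , gp≡y) →
      typeSet⊆xs y (g , g∈G , (λ x → g-fixes x ∘ F⊆F′) , gp≡y))
  Ranked-mono {F′ = F′} F⊆F′ (rankStep F″ F⊆F″ ranked) =
    rankStep (F″ ++ F′) (λ _ → xs⊆ys++xs F′ F″)
      (λ q (g , g∈G , g-fixes , gp≡q) →
        Ranked-mono (xs⊆xs++ys F″ F′) (ranked q (g , g∈G , (λ x → g-fixes x ∘ F⊆F′) , gp≡q)))

  Ranked-typeSet : ∀ {F p q} → Ranked G F p → TypeSet G F p q → Ranked G F q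
  Ranked-typeSet (rank0 (xs , typeSet⊆xs)) t =
    rank0 (xs , λ y t′ → typeSet⊆xs y (TypeSet-trans t t′))
  Ranked-typeSet (rankStep F′ F⊆F′ ranked) t =
    rankStep F′ F⊆F′ (λ q t′ → ranked q (TypeSet-trans t t′))

  Ranked-conj : ∀ {k F p} → G k → Ranked G F p → Ranked G (map (ap k) F) (ap k p)
  Ranked-conj {k} k∈G (rank0 (xs , typeSet⊆xs)) =
    rank0 (map (ap k) xs , λ y t →
      subst (_∈ map (ap k) xs) (ap-inverseʳ k y)
            (∈-map⁺ (ap k) (typeSet⊆xs _ (TypeSet-unconj k∈G t))))
  Ranked-conj {k} k∈G (rankStep F′ F⊆F′ ranked) =
    rankStep (map (ap k) F′) (λ _ → map⁺-⊆ₗ (ap k) (F⊆F′ _))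
      (λ q t → subst (Ranked G (map (ap k) F′)) (ap-inverseʳ k q)
                     (Ranked-conj k∈G (ranked _ (TypeSet-unconj k∈G t))))

  Ranked-∈ : ∀ {F x} → x ∈ F → Ranked G F x
  Ranked-∈ {x = x} x∈F =
    rank0 (x ∷ [] , λ y (g , _ , g-fixes , gx≡y) → here (trans (sym gx≡y) (g-fixes x x∈F)))

  rcFin⇒Ranked : ∀ {F x} → rcFin G F x → Ranked G F x
  rcFin⇒Ranked (inj₁ x∈F) = Ranked-∈ x∈F
  rcFin⇒Ranked (inj₂ (p , ranked , t)) = Ranked-typeSet ranked t

  Ranked⇒rcFin : ∀ {F x} → Ranked G F x → rcFin G F x
  Ranked⇒rcFin {x = x} ranked = inj₂ (x , ranked , TypeSet-refl)

  Ranked-image : ∀ {F f w} → Closure G f → FixesMap F f → Ranked G F w → Ranked G F (f w)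
  Ranked-image {F} {f} {w} f-cl f-fixes ranked =
    let g , g∈G , g≈f = f-cl (w ∷ F)
    in Ranked-typeSet ranked
         (g , g∈G , (λ x x∈F → trans (g≈f x (there x∈F)) (f-fixes x x∈F)) , g≈f w (here refl))

  Ranked⊆Image : ∀ {F f y} → Closure G f → FixesMap F f → Ranked G F y → Image G f y
  Ranked⊆Image {F} {f} {y} f-cl f-fixes (rank0 (xs , typeSet⊆xs)) =
    let g , g∈G , g≈f = f-cl (F ++ xs)
        g-fixes : Fixes G F g
        g-fixes x x∈F = trans (g≈f x (xs⊆xs++ys F xs x∈F)) (f-fixes x x∈F)
        g⁻¹y∈xs = typeSet⊆xs _ (TypeSet-⁻¹ g∈G g-fixes y)
    in ap (g ⁻¹) y , trans (sym (g≈f _ (xs⊆ys++xs xs F g⁻¹y∈xs))) (ap-inverseʳ g y)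
  Ranked⊆Image {F} {f} {y} f-cl f-fixes (rankStep F′ F⊆F′ ranked) =
    let g , g∈G , g≈f = f-cl F′
        g-fixes : Fixes G F g
        g-fixes x x∈F = trans (g≈f x (F⊆F′ x x∈F)) (f-fixes x x∈F)
        g⁻¹f-fixes : FixesMap F′ (ap (g ⁻¹) ∘ f)
        g⁻¹f-fixes x x∈F′ = trans (cong (ap (g ⁻¹)) (sym (g≈f x x∈F′))) (ap-inverseˡ g x)
        u , g⁻¹fu≡g⁻¹y =
          Ranked⊆Image (Closure-∘ (Closure-perm (inv∈ g g∈G)) f-cl) g⁻¹f-fixes
                       (ranked _ (TypeSet-⁻¹ g∈G g-fixes y))
    in u , trans (sym (ap-inverseʳ g (f u)))
                 (trans (cong (ap g) g⁻¹fu≡g⁻¹y) (ap-inverseʳ g y))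

  preimages : ∀ {f F} → All (Image G f) F → List U
  preimages [] = []
  preimages ((u , _) ∷ ps) = u ∷ preimages ps

  map-preimages : ∀ {f F} (ps : All (Image G f) F) → map f (preimages ps) ≡ F
  map-preimages [] = refl
  map-preimages ((_ , fu≡x) ∷ ps) = cong₂ _∷_ fu≡x (map-preimages ps)

  -- If f ∈ Ḡ hits F, then precomposing f with an element of G agreeing with f
  -- on the preimages of F gives an element of Ḡ fixing F with a smaller image.
  Closure-fixing : ∀ {f F} → Closure G f → All (Image G f) F →
                   Σ (U → U) λ f′ → Closure G f′ × FixesMap F f′ × Image G f′ ⊆ Image G f
  Closure-fixing {f} {F} f-cl F⊆f with f-cl (preimages F⊆f)
  ... | h , h∈G , h≈f =
    f ∘ ap (h ⁻¹) , Closure-∘ f-cl (Closure-perm (inv∈ h h∈G)) , fixes ,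
    λ _ (v , e) → ap (h ⁻¹) v , e
    where
    fixes : FixesMap F (f ∘ ap (h ⁻¹))
    fixes x x∈F with ∈-map⁻ f (subst (x ∈_) (sym (map-preimages F⊆f)) x∈F)
    ... | u , u∈ , refl = cong f (trans (cong (ap (h ⁻¹)) (sym (h≈f u u∈))) (ap-inverseˡ h u))

  rc-least : ExcludedMiddle 0ℓ → (S A : Subset U) → ClosureOfImages G A → S ⊆ A → rc G S ⊆ A
  rc-least em S A A-closed S⊆A x (F , F⊆S , x∈rcF) with em {A x}
  ... | yes x∈A = x∈A
  ... | no x∉A with A-closed F (x ∷ []) (All.map (λ {y} → S⊆A y) F⊆S , x∉A ∷ [])
  ... | B , (f , f-cl , B⊆f , f⊆B) , F⊆B , x∉B ∷ [] with Closure-fixing f-cl (All.map (λ {y} → B⊆f y) F⊆B)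
  ... | f′ , f′-cl , f′-fixes , f′⊆f =
    ⊥-elim (x∉B (f⊆B x (f′⊆f x (Ranked⊆Image f′-cl f′-fixes (rcFin⇒Ranked x∈rcF)))))

  rc-collect : ∀ {S F₀} → All (rc G S) F₀ → Σ (List U) λ F → All S F × All (Ranked G F) F₀
  rc-collect [] = [] , [] , []
  rc-collect ((F , F⊆S , x∈rcF) ∷ rest) with rc-collect rest
  ... | F′ , F′⊆S , ranked =
    F ++ F′ , ++⁺ F⊆S F′⊆S ,
    Ranked-mono (xs⊆xs++ys F F′) (rcFin⇒Ranked x∈rcF) ∷ All.map (Ranked-mono (xs⊆ys++xs F′ F)) ranked

  module Limit (enum : ℕ → U) (enum-onto : StrictlySurjective _≡_ enum) (F : List U) where
    index : U → ℕ
    index x = proj₁ (enum-onto x)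

    stage : ℕ → List U
    stage zero = F
    stage (ℕ.suc n) = enum n ∷ stage n

    stage-mono : ∀ {m n} → m ≤′ n → stage m ⊆ₗ stage n
    stage-mono ≤′-refl = id
    stage-mono (≤′-step m≤n) = there ∘ stage-mono m≤n

    ∈-stage-index : ∀ x → x ∈ stage (ℕ.suc (index x))
    ∈-stage-index x = here (sym (proj₂ (enum-onto x)))

    stages-exhaust : ∀ xs → ∃ λ n → xs ⊆ₗ stage n
    stages-exhaust [] = 0 , λ ()
    stages-exhaust (x ∷ xs) with stages-exhaust xs
    ... | n , xs⊆ = m ⊔ n , λ where
        (here refl) → stage-mono (≤⇒≤′ (m≤m⊔n m n)) (∈-stage-index x)
        (there y∈)  → stage-mono (≤⇒≤′ (m≤n⊔m m n)) (xs⊆ y∈)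
      where m = ℕ.suc (index x)

    module _ (gs : ℕ → Perm U) (gs∈G : ∀ n → G (gs n))
             (coherent : ∀ n {x} → x ∈ stage n → ap (gs (ℕ.suc n)) x ≡ ap (gs n) x) where
      limit : U → U
      limit x = ap (gs (ℕ.suc (index x))) x

      stable : ∀ {m n x} → m ≤′ n → x ∈ stage m → ap (gs n) x ≡ ap (gs m) x
      stable ≤′-refl _ = refl
      stable (≤′-step {n} m≤n) x∈ = trans (coherent n (stage-mono m≤n x∈)) (stable m≤n x∈)

      limit-agrees : ∀ {n x} → x ∈ stage n → limit x ≡ ap (gs n) x
      limit-agrees {n} {x} x∈ =
        trans (sym (stable (≤⇒≤′ (m≤m⊔n m n)) (∈-stage-index x))) (stable (≤⇒≤′ (m≤n⊔m m n)) x∈)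
        where m = ℕ.suc (index x)

      limit-closure : Closure G limit
      limit-closure xs =
        let n , xs⊆ = stages-exhaust xs
        in gs n , gs∈G n , λ x x∈ → sym (limit-agrees (xs⊆ x∈))

  module _ (em : ExcludedMiddle 0ℓ) where

    unranked-extend : ∀ {K e} → ¬ Ranked G K e → ∀ a →
                      Σ (Perm U) λ h → G h × Fixes G K h × ¬ Ranked G (map (ap h) (a ∷ K)) e
    unranked-extend {K} {e} unranked a
      with counterexample em (λ ranked-all → unranked (rankStep (a ∷ K) (λ _ → there) ranked-all))
    ... | q , (h , h∈G , h-fixes , he≡q) , unranked-q =
      h ⁻¹ , inv∈ h h∈G , Fixes-⁻¹ {K} {h} h-fixes ,
      λ ranked → unranked-q (subst (Ranked G (a ∷ K)) he≡q
        (subst (λ L → Ranked G L (ap h e)) (map-ap-inverseʳ h (a ∷ K)) (Ranked-conj h∈G ranked)))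

    module _ (enum : ℕ → U) (enum-onto : StrictlySurjective _≡_ enum) where

      unranked-avoid : ∀ {F e} → ¬ Ranked G F e →
                       Σ (U → U) λ f → Closure G f × FixesMap F f × ¬ Image G f e
      unranked-avoid {F} {e} unranked =
        limit gs gs∈G coherent , limit-closure gs gs∈G coherent , fixes , avoids
        where
        open Limit enum enum-onto F

        Invariant : ℕ → Set
        Invariant n = Σ (Perm U) λ g → G g × ¬ Ranked G (map (ap g) (stage n)) e

        Extends : ∀ n → Invariant n → Invariant (ℕ.suc n) → Set
        Extends n (g , _) (g′ , _) = ∀ {x} → x ∈ stage n → ap g′ x ≡ ap g x

        extend : ∀ n (s : Invariant n) → Σ (Invariant (ℕ.suc n)) (Extends n s)
        extend n (g , g∈G , unranked-g) with unranked-extend unranked-g (ap g (enum n))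
        ... | h , h∈G , h-fixes , unranked-h =
          (↔-trans g h , ∘∈ h g h∈G g∈G ,
           subst (λ L → ¬ Ranked G L e) (sym (map-∘ (enum n ∷ stage n))) unranked-h) ,
          λ x∈ → h-fixes _ (∈-map⁺ (ap g) x∈)

        sequence : ∀ n → Invariant n
        sequence zero = ↔-refl , id∈ , subst (λ L → ¬ Ranked G L e) (sym (map-id F)) unranked
        sequence (ℕ.suc n) = proj₁ (extend n (sequence n))

        gs : ℕ → Perm U
        gs n = proj₁ (sequence n)

        gs∈G : ∀ n → G (gs n)
        gs∈G n = proj₁ (proj₂ (sequence n))

        coherent : ∀ n {x} → x ∈ stage n → ap (gs (ℕ.suc n)) x ≡ ap (gs n) x
        coherent n = proj₂ (extend n (sequence n))

        fixes : FixesMap F (limit gs gs∈G coherent)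
        fixes x x∈F = limit-agrees gs gs∈G coherent {0} x∈F

        avoids : ¬ Image G (limit gs gs∈G coherent) e
        avoids (x , fx≡e) =
          proj₂ (proj₂ (sequence m))
            (subst (Ranked G _) fx≡e (Ranked-∈ (∈-map⁺ (ap (gs m)) (∈-stage-index x))))
          where m = ℕ.suc (index x)

      unranked-avoidAll : ∀ {F E} → All (λ e → ¬ Ranked G F e) E →
                          Σ (U → U) λ f → Closure G f × FixesMap F f × All (λ e → ¬ Image G f e) E
      unranked-avoidAll [] = id , Closure-perm id∈ , (λ _ _ → refl) , []
      unranked-avoidAll {F} {e ∷ E} (unranked-e ∷ unranked-E) with unranked-avoidAll unranked-E
      ... | f , f-cl , f-fixes , f-avoids with em {Image G f e}
      ... | no e∉f = f , f-cl , f-fixes , e∉f ∷ f-avoids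
      ... | yes (w , fw≡e)
        with unranked-avoid (λ ranked → unranked-e (subst (Ranked G F) fw≡e (Ranked-image f-cl f-fixes ranked)))
      ... | f′ , f′-cl , f′-fixes , w∉f′ =
        f ∘ f′ , Closure-∘ f-cl f′-cl ,
        (λ x x∈F → trans (cong f (f′-fixes x x∈F)) (f-fixes x x∈F)) ,
        (λ (x , ff′x≡e) → w∉f′ (x , Closure-injective f-cl (trans ff′x≡e (sym fw≡e)))) ∷
        All.map (λ e′∉f (x , fx≡e′) → e′∉f (f′ x , fx≡e′)) f-avoids

      rc-closureOfImages : ∀ S → ClosureOfImages G (rc G S)
      rc-closureOfImages S F₀ E (F₀⊆rc , E∩rc≡∅) with rc-collect F₀⊆rc
      ... | F , F⊆S , ranked
        with unranked-avoidAll (All.map (λ e∉rc r → e∉rc (F , F⊆S , Ranked⇒rcFin r)) E∩rc≡∅)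
      ... | f , f-cl , f-fixes , f-avoids =
        Image G f , (f , f-cl , (λ _ y → y) , (λ _ y → y)) ,
        All.map (Ranked⊆Image f-cl f-fixes) ranked , f-avoids

theorem9p4 : ExcludedMiddle 0ℓ → ExcludedMiddle (suc 0ℓ) →
    (U : Set) → CountablyInfinite U →
    (G : Perm U → Set) → IsSubgroup G →
    (S : Subset U) →
      ClosureOfImages G (rc G S) × S ⊆ rc G S ×
      ((A : Subset U) → ClosureOfImages G A → S ⊆ A → rc G S ⊆ A)
theorem9p4 em _ U ℕ⤖U G G-subgroup S =
  rc-closureOfImages em (Bijection.to ℕ⤖U) (Bijection.strictlySurjective ℕ⤖U) S ,
  (λ x x∈S → x ∷ [] , x∈S ∷ [] , inj₁ (here refl)) ,
  rc-least em S
  where open Subgroup G-subgroup
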